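{- For any connected graph $G$, every DFS ordering of $G$ is a LexDFS ordering of $G$ if and only if $G$ is $\{\text{pan}, \text{diamond}\}$-free.
   Context: All graphs are finite and simple. For an ordering $\sigma$ of $V(G)$ write $x<_\sigma y$ if $x$ precedes $y$. $\sigma$ is a DFS ordering if whenever $a<_\sigma b<_\sigma c$, $ac\in E(G)$, $ab\notin E(G)$, there is $d$ with $a<_\sigma d<_\sigma b$ and $db\in E(G)$; it is a LexDFS ordering if under the same conditions there is $d$ with $a<_\sigma d<_\sigma b$, $db\in E(G)$ and $dc\notin E(G)$. For $k\ge3$ a $k$-pan is a $k$-cycle plus one extra vertex adjacent to exactly one cycle vertex; pan-free means no induced $k$-pan for any $k\ge3$. The diamond is $K_4$ minus one edge; $\{\text{pan},\text{diamond}\}$-free means no induced pan and no induced diamond. -}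

module Defs where

open import Level using (0ℓ)
open import Data.Nat using (ℕ; zero; suc; _+_; _≤_; _<_)
open import Data.Fin using (Fin; toℕ) renaming (_<_ to _<ᶠ_)
open import Data.Product using (Σ; ∃; _×_; _,_)
open import Data.Sum using (_⊎_)
open import Relation.Nullary using (¬_; Dec)
open import Relation.Binary.PropositionalEquality using (_≡_)
open import Function.Bundles using (_↔_; Inverse; _⇔_)
open import Function.Definitions using (Injective)

record Graph : Set₁ where
  field
    n     : ℕ
    E     : Fin n → Fin n → Set
    E?    : ∀ x y → Dec (E x y)
    sym   : ∀ {x y} → E x y → E y x
    irrefl : ∀ {x} → ¬ E x x

open Graph public

data Walk (G : Graph) : Fin (n G) → Fin (n G) → Set where
  here : ∀ {x} → Walk G x x
  step : ∀ {x y z} → E G x y → Walk G y z → Walk G x z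

Connected : Graph → Set
Connected G = ∀ x y → Walk G x y

-- An ordering of V(G): a bijection from vertices to positions 0..n-1.
Ordering : Graph → Set
Ordering G = Fin (n G) ↔ Fin (n G)

Before : (G : Graph) → Ordering G → Fin (n G) → Fin (n G) → Set
Before G σ x y = Inverse.to σ x <ᶠ Inverse.to σ y

IsDFS : (G : Graph) → Ordering G → Set
IsDFS G σ = ∀ a b c → Before G σ a b → Before G σ b c → E G a c → ¬ E G a b →
  ∃ λ d → Before G σ a d × Before G σ d b × E G d b

IsLexDFS : (G : Graph) → Ordering G → Set
IsLexDFS G σ = ∀ a b c → Before G σ a b → Before G σ b c → E G a c → ¬ E G a b →
  ∃ λ d → Before G σ a d × Before G σ d b × E G d b × ¬ E G d c

InducedCopy : (m : ℕ) → (Fin m → Fin m → Set) → Graph → Set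
InducedCopy m H G = Σ (Fin m → Fin (n G)) λ f →
  Injective _≡_ _≡_ f × (∀ i j → H i j ⇔ E G (f i) (f j))

-- Adjacency of the k-cycle on 0..k-1 (as naturals, one direction):
-- b = a+1, or a = 0 and b = k-1.
CycStep : ℕ → ℕ → ℕ → Set
CycStep k a b = b ≡ suc a ⊎ (a ≡ 0 × suc b ≡ k)

-- k-pan on Fin (suc k): vertices 0..k-1 form a k-cycle,
-- vertex k is the pendant vertex adjacent to vertex 0 only.
PanAdj : (k : ℕ) → Fin (suc k) → Fin (suc k) → Set
PanAdj k i j =
    (toℕ i < k × toℕ j < k × (CycStep k (toℕ i) (toℕ j) ⊎ CycStep k (toℕ j) (toℕ i)))
  ⊎ (toℕ i ≡ k × toℕ j ≡ 0)
  ⊎ (toℕ i ≡ 0 × toℕ j ≡ k)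

-- Diamond (K4 minus the edge {0,3}) on Fin 4.
DiamondAdj : Fin 4 → Fin 4 → Set
DiamondAdj i j = ¬ (toℕ i ≡ toℕ j) × ¬ (toℕ i ≡ 0 × toℕ j ≡ 3) × ¬ (toℕ i ≡ 3 × toℕ j ≡ 0)

PanDiamondFree : Graph → Set
PanDiamondFree G = (∀ k → 3 ≤ k → ¬ InducedCopy (suc k) (PanAdj k) G)
                 × ¬ InducedCopy 4 DiamondAdj G

{-# OPTIONS --safe #-}
-- Let σ be a DFS ordering and a <σ b <σ c with a ~ c and a ≁ b. Starting at b, move repeatedly to the
-- leftmost neighbour lying after a. The DFS condition keeps this descent going until it reaches a
-- neighbour of a, and the choice of leftmost neighbours makes it an induced path b, z₁, …, zⱼ. If z₁ ≁ c,
-- then z₁ is the vertex the LexDFS condition asks for. Otherwise, when b ≁ c, the vertex c sees z₁ and a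
-- (appended to the path) but not b, so c and the stretch of the path from z₁ to the next neighbour of c
-- form an induced cycle with pendant b; when b ~ c, the vertices a, z₁, c, b span a diamond or a triangle
-- with pendant a.
--
-- Conversely, in a connected graph every path extends to a DFS ordering, obtained by always appending an
-- unvisited neighbour of the latest vertex that has one. Beginning with the path 2, 3, …, k − 1, 0, k of a
-- k-pan, or 0, 1, 3 of a diamond, the remaining vertex 1, resp. 2, sees the first vertex of the path and
-- the only neighbour of its last vertex inside the path, so the ordering violates the LexDFS condition.
module Submission where

open import Defs hiding (sym)
open import Data.Nat using (ℕ; zero; suc; _+_; _∸_; _<_; _≤_; z≤n; s≤s; s≤s⁻¹; _<?_; _≤?_)
open import Data.Nat.Properties
open import Data.Nat.Induction using (<-rec)
open import Data.Fin using (Fin; toℕ; fromℕ<)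
open import Data.Fin.Patterns using (0F; 1F; 2F; 3F)
open import Data.Fin.Properties using (toℕ-injective; toℕ<n; toℕ-fromℕ<; any?; injective⇒≤; ¬∀⟶∃¬)
  renaming (_≟_ to _≟ᶠ_)
open import Data.Product using (Σ; ∃; ∃₂; _×_; _,_; proj₁; proj₂)
open import Data.Sum using (_⊎_; inj₁; inj₂)
open import Function using (_∘_)
open import Function.Bundles using (_⇔_; mk⇔; Equivalence; Inverse; mk↔ₛ′)
open import Relation.Binary.Definitions using (tri<; tri≈; tri>)
open import Relation.Nullary using (¬_; Dec; yes; no; ¬?; contradiction)
open import Relation.Nullary.Decidable using (_×-dec_; True; toWitness; from-yes; from-no)
open import Relation.Unary using (Decidable)
open import Relation.Binary.PropositionalEquality

-- Sequences

module _ {A : Set} where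

  snoc : (ℕ → A) → ℕ → A → ℕ → A
  snoc s m x t with t <? m
  ... | yes _ = s t
  ... | no _ = x

  snoc-< : ∀ {s m x t} → t < m → snoc s m x t ≡ s t
  snoc-< {m = m} {t = t} t<m with t <? m
  ... | yes _ = refl
  ... | no t≮m = contradiction t<m t≮m

  snoc-last : ∀ {s m x} → snoc s m x m ≡ x
  snoc-last {m = m} with m <? m
  ... | yes m<m = contradiction m<m (<-irrefl refl)
  ... | no _ = refl

  data SnocView (s : ℕ → A) (m : ℕ) (x : A) (t : ℕ) : Set where
    old : t < m → snoc s m x t ≡ s t → SnocView s m x t
    new : t ≡ m → snoc s m x t ≡ x → SnocView s m x t

  snoc-view : ∀ {s m x t} → t < suc m → SnocView s m x t
  snoc-view {s} {m} {x} t<1+m with m<1+n⇒m<n∨m≡n t<1+m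
  ... | inj₁ t<m = old t<m (snoc-< t<m)
  ... | inj₂ refl = new refl (snoc-last {s} {m} {x})

  snoc-all : ∀ {P : A → Set} {s m x} → (∀ {t} → t < m → P (s t)) → P x →
             ∀ {t} → t < suc m → P (snoc s m x t)
  snoc-all {P} all px t<1+m with snoc-view t<1+m
  ... | old t<m q = subst P (sym q) (all t<m)
  ... | new _ q = subst P (sym q) px

  InjectiveBelow : ℕ → (ℕ → A) → Set
  InjectiveBelow m s = ∀ {t u} → t < m → u < m → s t ≡ s u → t ≡ u

  Consecutive : (A → A → Set) → ℕ → (ℕ → A) → Set
  Consecutive R m s = ∀ {t} → suc t < m → R (s t) (s (suc t))

  injectiveBelow-1 : ∀ {s} → InjectiveBelow 1 s
  injectiveBelow-1 (s≤s z≤n) (s≤s z≤n) _ = refl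

  consecutive-1 : ∀ {R s} → Consecutive R 1 s
  consecutive-1 (s≤s ())

  snoc-injective : ∀ {s m x} → InjectiveBelow m s → (∀ {t} → t < m → s t ≢ x) →
                   InjectiveBelow (suc m) (snoc s m x)
  snoc-injective inj fresh t<1+m u<1+m eq with snoc-view t<1+m | snoc-view u<1+m
  ... | old t<m p | old u<m q = inj t<m u<m (trans (sym p) (trans eq q))
  ... | old t<m p | new refl q = contradiction (trans (sym p) (trans eq q)) (fresh t<m)
  ... | new refl p | old u<m q = contradiction (trans (sym q) (trans (sym eq) p)) (fresh u<m)
  ... | new refl _ | new refl _ = refl

  snoc-consecutive : ∀ {R s m x} → Consecutive R (suc m) s → R (s m) x →
                     Consecutive R (suc (suc m)) (snoc s (suc m) x)
  snoc-consecutive {R} {s} {m} {x} steps last {t} 1+t<2+m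
    with snoc-view {s} {suc m} {x} {suc t} 1+t<2+m
  ... | old 1+t<1+m q = subst₂ R (sym (snoc-< (s≤s⁻¹ 1+t<2+m))) (sym q) (steps 1+t<1+m)
  ... | new refl q = subst₂ R (sym (snoc-< (s≤s⁻¹ 1+t<2+m))) (sym q) last

module _ {P : ℕ → Set} (P? : Decidable P) where

  least : ∀ {m} → P m → ∃ λ i → P i × (∀ {u} → u < i → ¬ P u)
  least {m} = <-rec (λ m → P m → ∃ λ i → P i × (∀ {u} → u < i → ¬ P u)) search m
    where
    search : ∀ m → (∀ {u} → u < m → P u → ∃ λ i → P i × (∀ {u} → u < i → ¬ P u)) →
             P m → ∃ λ i → P i × (∀ {u} → u < i → ¬ P u)
    search m smaller pm with anyUpTo? P? m
    ... | yes (u , u<m , pu) = smaller u<m pu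
    ... | no none = m , pm , λ u<m pu → none (_ , u<m , pu)

  greatest-below : ∀ {m} → (∃ λ t → t < m × P t) →
                   ∃ λ t → t < m × P t × (∀ {u} → t < u → u < m → ¬ P u)
  greatest-below {suc m} (t , t<1+m , pt) with P? m
  ... | yes pm = m , ≤-refl , pm , λ m<u u<1+m _ → <⇒≱ m<u (s≤s⁻¹ u<1+m)
  ... | no ¬pm with m<1+n⇒m<n∨m≡n t<1+m
  ...   | inj₂ refl = contradiction pt ¬pm
  ...   | inj₁ t<m with greatest-below (t , t<m , pt)
  ...     | g , g<m , pg , above = g , m<n⇒m<1+n g<m , pg , beyond
    where
    beyond : ∀ {u} → g < u → u < suc m → ¬ P u
    beyond g<u u<1+m with m<1+n⇒m<n∨m≡n u<1+m
    ... | inj₁ u<m = above g<u u<m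
    ... | inj₂ refl = ¬pm

-- PanAdj k i j and DiamondAdj i j unfold to these relations applied to toℕ i and toℕ j.
PanAdjℕ : ℕ → ℕ → ℕ → Set
PanAdjℕ k t u = (t < k × u < k × (CycStep k t u ⊎ CycStep k u t)) ⊎ (t ≡ k × u ≡ 0) ⊎ (t ≡ 0 × u ≡ k)

DiamondAdjℕ : ℕ → ℕ → Set
DiamondAdjℕ t u = ¬ (t ≡ u) × ¬ (t ≡ 0 × u ≡ 3) × ¬ (t ≡ 3 × u ≡ 0)

diamondAdjℕ? : ∀ t u → Dec (DiamondAdjℕ t u)
diamondAdjℕ? t u = ¬? (t ≟ u) ×-dec ¬? (t ≟ 0 ×-dec u ≟ 3) ×-dec ¬? (t ≟ 3 ×-dec u ≟ 0)

panAdjℕ-pendant : ∀ {k t} → PanAdjℕ (suc k) t (suc k) → t ≡ 0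
panAdjℕ-pendant (inj₁ (_ , k<k , _)) = contradiction k<k (<-irrefl refl)
panAdjℕ-pendant (inj₂ (inj₁ (_ , ())))
panAdjℕ-pendant (inj₂ (inj₂ (t≡0 , _))) = t≡0

module _ (G : Graph) where

  private
    V : Set
    V = Fin (n G)

    _~_ : V → V → Set
    _~_ = E G

    ~-sym : ∀ {x y} → x ~ y → y ~ x
    ~-sym = Graph.sym G

  -- Induced paths, pans and diamonds

  adjacent⇒≢ : ∀ {x y} → x ~ y → x ≢ y
  adjacent⇒≢ x~y refl = irrefl G x~y

  record IsPath (m : ℕ) (w : ℕ → V) : Set where
    field
      distinct : InjectiveBelow m w
      steps    : Consecutive _~_ m w

  record IsInducedPath (m : ℕ) (w : ℕ → V) : Set where
    field
      isPath    : IsPath m w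
      chordless : ∀ {t u} → t < u → u < m → w t ~ w u → suc t ≡ u

  isPath-prefix : ∀ {m m′ w} → m ≤ m′ → IsPath m′ w → IsPath m w
  isPath-prefix m≤m′ path = record
    { distinct = λ t<m u<m → IsPath.distinct path (<-≤-trans t<m m≤m′) (<-≤-trans u<m m≤m′)
    ; steps    = λ 1+t<m → IsPath.steps path (<-≤-trans 1+t<m m≤m′)
    }

  snoc-isPath : ∀ {m w x} → IsPath (suc m) w → w m ~ x → (∀ {t} → t < suc m → w t ≢ x) →
                IsPath (suc (suc m)) (snoc w (suc m) x)
  snoc-isPath path last fresh = record
    { distinct = snoc-injective (IsPath.distinct path) fresh
    ; steps    = snoc-consecutive {R = _~_} (IsPath.steps path) last
    }

  singleton-isInducedPath : ∀ v → IsInducedPath 1 (λ _ → v)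
  singleton-isInducedPath v = record
    { isPath    = record { distinct = injectiveBelow-1 ; steps = consecutive-1 {R = _~_} }
    ; chordless = λ { () (s≤s z≤n) _ }
    }

  snoc-isInducedPath : ∀ {m w x} → IsInducedPath (suc m) w → w m ~ x →
                       (∀ {t} → t < m → ¬ (w t ~ x)) → (∀ {t} → t < suc m → w t ≢ x) →
                       IsInducedPath (suc (suc m)) (snoc w (suc m) x)
  snoc-isInducedPath {m} {w} {x} path last nonadjacent fresh = record
    { isPath    = snoc-isPath (IsInducedPath.isPath path) last fresh
    ; chordless = chordless
    }
    where
    chordless : ∀ {t u} → t < u → u < suc (suc m) →
                snoc w (suc m) x t ~ snoc w (suc m) x u → suc t ≡ u
    chordless {t} {u} t<u u<2+m e with snoc-view {s = w} {m = suc m} {x = x} {t = u} u<2+m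
    ... | old u<1+m q =
      IsInducedPath.chordless path t<u u<1+m (subst₂ _~_ (snoc-< (<-trans t<u u<1+m)) q e)
    ... | new refl q with m<1+n⇒m<n∨m≡n t<u
    ...   | inj₁ t<m = contradiction (subst₂ _~_ (snoc-< t<u) q e) (nonadjacent t<m)
    ...   | inj₂ refl = refl

  sequence⇒inducedCopy : ∀ {m} {R : ℕ → ℕ → Set} (w : ℕ → V) → InjectiveBelow m w →
                         (∀ {t u} → t < m → u < m → R t u ⇔ w t ~ w u) →
                         InducedCopy m (λ i j → R (toℕ i) (toℕ j)) G
  sequence⇒inducedCopy w inj adjacency =
    (λ i → w (toℕ i)) ,
    (λ eq → toℕ-injective (inj (toℕ<n _) (toℕ<n _) eq)) ,
    (λ i j → adjacency (toℕ<n i) (toℕ<n j))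

  HasInducedPan : Set
  HasInducedPan = ∃ λ k → 3 ≤ k × InducedCopy (suc k) (PanAdj k) G

  chordedPath⇒pan : ∀ {k w} → 3 ≤ k → IsPath (suc k) w → w 1 ~ w k →
                    (∀ {t u} → t < u → u ≤ k → w t ~ w u → suc t ≡ u ⊎ (t ≡ 1 × u ≡ k)) →
                    HasInducedPan
  chordedPath⇒pan {k} {w} 3≤k path chord only-edges =
    k , 3≤k , sequence⇒inducedCopy h h-injective λ t< u< → mk⇔ adjacent-if (adjacent-only-if t< u<)
    where
    open IsPath path

    -- The cycle w 1, …, w k comes first and the pendant w 0 last, as in PanAdj.
    h : ℕ → V
    h = snoc (w ∘ suc) k (w 0)

    0<k : 0 < k
    0<k = ≤-trans (s≤s z≤n) 3≤k

    h-injective : InjectiveBelow (suc k) h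
    h-injective = snoc-injective (λ t<k u<k eq → suc-injective (distinct (s≤s t<k) (s≤s u<k) eq))
                                 (λ t<k eq → 1+n≢0 (distinct (s≤s t<k) (s≤s z≤n) eq))

    cycle-edge : ∀ {t u} → t < k → u < k → CycStep k t u → h t ~ h u
    cycle-edge t<k u<k (inj₁ refl) =
      subst₂ _~_ (sym (snoc-< t<k)) (sym (snoc-< u<k)) (steps (s≤s u<k))
    cycle-edge t<k u<k (inj₂ (refl , 1+u≡k)) =
      subst₂ _~_ (sym (snoc-< t<k)) (sym (snoc-< u<k)) (subst (λ v → w 1 ~ w v) (sym 1+u≡k) chord)

    pendant-edge : h k ~ h 0
    pendant-edge = subst₂ _~_ (sym (snoc-last {s = w ∘ suc} {m = k})) (sym (snoc-< 0<k)) (steps (s≤s 0<k))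

    as-cycStep : ∀ {t u} → suc (suc t) ≡ suc u ⊎ (suc t ≡ 1 × suc u ≡ k) → CycStep k t u
    as-cycStep (inj₁ eq) = inj₁ (sym (suc-injective eq))
    as-cycStep (inj₂ (refl , 1+u≡k)) = inj₂ (refl , 1+u≡k)

    cycle-classify : ∀ {t u} → t < k → u < k → w (suc t) ~ w (suc u) → CycStep k t u ⊎ CycStep k u t
    cycle-classify {t} {u} t<k u<k e with <-cmp t u
    ... | tri< t<u _ _ = inj₁ (as-cycStep (only-edges (s≤s t<u) u<k e))
    ... | tri≈ _ refl _ = contradiction e (irrefl G)
    ... | tri> _ _ u<t = inj₂ (as-cycStep (only-edges (s≤s u<t) t<k (~-sym e)))

    pendant-classify : ∀ {u} → u < k → h k ~ h u → u ≡ 0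
    pendant-classify {zero} _ _ = refl
    pendant-classify {suc u} u<k e
      with only-edges (s≤s z≤n) u<k (subst₂ _~_ (snoc-last {s = w ∘ suc} {m = k}) (snoc-< u<k) e)
    ... | inj₁ ()
    ... | inj₂ (() , _)

    adjacent-if : ∀ {t u} → PanAdjℕ k t u → h t ~ h u
    adjacent-if (inj₁ (t<k , u<k , inj₁ cs)) = cycle-edge t<k u<k cs
    adjacent-if (inj₁ (t<k , u<k , inj₂ cs)) = ~-sym (cycle-edge u<k t<k cs)
    adjacent-if (inj₂ (inj₁ (refl , refl))) = pendant-edge
    adjacent-if (inj₂ (inj₂ (refl , refl))) = ~-sym pendant-edge

    adjacent-only-if : ∀ {t u} → t < suc k → u < suc k → h t ~ h u → PanAdjℕ k t u
    adjacent-only-if t<1+k u<1+k e with m<1+n⇒m<n∨m≡n t<1+k | m<1+n⇒m<n∨m≡n u<1+k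
    ... | inj₁ t<k | inj₁ u<k = inj₁ (t<k , u<k , cycle-classify t<k u<k (subst₂ _~_ (snoc-< t<k) (snoc-< u<k) e))
    ... | inj₂ refl | inj₁ u<k = inj₂ (inj₁ (refl , pendant-classify u<k e))
    ... | inj₁ t<k | inj₂ refl = inj₂ (inj₂ (pendant-classify t<k (~-sym e) , refl))
    ... | inj₂ refl | inj₂ refl = contradiction e (irrefl G)

  closingVertex⇒pan : ∀ {m z c} → IsInducedPath (suc m) z → 2 ≤ m → (∀ {t} → t < suc m → z t ≢ c) →
                      ¬ (z 0 ~ c) → z 1 ~ c → z m ~ c → HasInducedPan
  -- For the first i ≥ 2 with z i ~ c, the cycle z 1, …, z i, c is induced and z 0 hangs off z 1.
  closingVertex⇒pan {m} {z} {c} path 2≤m fresh z0≁c z1~c zm~c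
    with least (λ t → 2 ≤? t ×-dec E? G (z t) c) (2≤m , zm~c)
  ... | i , (2≤i , zi~c) , first =
    chordedPath⇒pan (s≤s 2≤i)
      (snoc-isPath (isPath-prefix (s≤s i≤m) (IsInducedPath.isPath path)) zi~c (fresh ∘ below-m))
      (subst₂ _~_ (sym (snoc-< (m≤n⇒m≤1+n 2≤i))) (sym (snoc-last {s = z} {m = suc i})) z1~c)
      only-edges
    where
    i≤m : i ≤ m
    i≤m = ≮⇒≥ λ m<i → first m<i (2≤m , zm~c)

    below-m : ∀ {t} → t < suc i → t < suc m
    below-m t<1+i = <-≤-trans t<1+i (s≤s i≤m)

    edge-to-c : ∀ {t} → z t ~ c → t < suc i → suc t ≡ suc i ⊎ (t ≡ 1 × suc i ≡ suc i)
    edge-to-c {0} e _ = contradiction e z0≁c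
    edge-to-c {1} e _ = inj₂ (refl , refl)
    edge-to-c {suc (suc t)} e t<1+i with m<1+n⇒m<n∨m≡n t<1+i
    ... | inj₁ t<i = contradiction (s≤s (s≤s z≤n) , e) (first t<i)
    ... | inj₂ refl = inj₁ refl

    only-edges : ∀ {t u} → t < u → u ≤ suc i → snoc z (suc i) c t ~ snoc z (suc i) c u →
                 suc t ≡ u ⊎ (t ≡ 1 × u ≡ suc i)
    only-edges {t} {u} t<u u≤1+i e with snoc-view {s = z} {m = suc i} {x = c} {t = u} (s≤s u≤1+i)
    ... | old u<1+i q =
      inj₁ (IsInducedPath.chordless path t<u (below-m u<1+i) (subst₂ _~_ (snoc-< (<-trans t<u u<1+i)) q e))
    ... | new refl q = edge-to-c (subst₂ _~_ (snoc-< t<u) q e) t<u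

  diamond⇒copy : ∀ {p q r s} → p ~ q → p ~ r → q ~ r → q ~ s → r ~ s → ¬ (p ~ s) → p ≢ s →
                 InducedCopy 4 DiamondAdj G
  diamond⇒copy {p} {q} {r} {s} pq pr qr qs rs p≁s p≢s = f , f-injective , λ i j → mk⇔ (edge i j) nonadjacent
    where
    f : Fin 4 → V
    f 0F = p
    f 1F = q
    f 2F = r
    f 3F = s

    edge : ∀ i j → DiamondAdj i j → f i ~ f j
    edge 0F 0F (i≢j , _) = contradiction refl i≢j
    edge 0F 1F _ = pq
    edge 0F 2F _ = pr
    edge 0F 3F (_ , ¬03 , _) = contradiction (refl , refl) ¬03
    edge 1F 0F _ = ~-sym pq
    edge 1F 1F (i≢j , _) = contradiction refl i≢j
    edge 1F 2F _ = qr
    edge 1F 3F _ = qs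
    edge 2F 0F _ = ~-sym pr
    edge 2F 1F _ = ~-sym qr
    edge 2F 2F (i≢j , _) = contradiction refl i≢j
    edge 2F 3F _ = rs
    edge 3F 0F (_ , _ , ¬30) = contradiction (refl , refl) ¬30
    edge 3F 1F _ = ~-sym qs
    edge 3F 2F _ = ~-sym rs
    edge 3F 3F (i≢j , _) = contradiction refl i≢j

    ends : ∀ {i j} → toℕ i ≡ 0 → toℕ j ≡ 3 → f i ≡ p × f j ≡ s
    ends {i} {j} i≡0 j≡3 =
      cong f (toℕ-injective {i = i} {j = 0F} i≡0) , cong f (toℕ-injective {i = j} {j = 3F} j≡3)

    nonadjacent : ∀ {i j} → f i ~ f j → DiamondAdj i j
    nonadjacent {i} {j} e =
      (λ i≡j → irrefl G (subst (λ v → f i ~ f v) (sym (toℕ-injective i≡j)) e)) ,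
      (λ (i≡0 , j≡3) → let (fi≡p , fj≡s) = ends i≡0 j≡3 in p≁s (subst₂ _~_ fi≡p fj≡s e)) ,
      (λ (i≡3 , j≡0) → let (fj≡p , fi≡s) = ends j≡0 i≡3 in p≁s (subst₂ _~_ fj≡p fi≡s (~-sym e)))

    f-injective : ∀ {i j} → f i ≡ f j → i ≡ j
    f-injective {i} {j} eq
      with toℕ i ≟ toℕ j | toℕ i ≟ 0 ×-dec toℕ j ≟ 3 | toℕ i ≟ 3 ×-dec toℕ j ≟ 0
    ... | yes i≡j | _ | _ = toℕ-injective i≡j
    ... | no _ | yes (i≡0 , j≡3) | _ = let (fi≡p , fj≡s) = ends i≡0 j≡3 in
      contradiction (trans (sym fi≡p) (trans eq fj≡s)) p≢s
    ... | no _ | _ | yes (i≡3 , j≡0) = let (fj≡p , fi≡s) = ends j≡0 i≡3 in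
      contradiction (trans (sym fj≡p) (trans (sym eq) fi≡s)) p≢s
    ... | no i≢j | no ¬03 | no ¬30 = contradiction eq (adjacent⇒≢ (edge i j (i≢j , ¬03 , ¬30)))

  module _ (σ : Ordering G) where

    position : V → ℕ
    position v = toℕ (Inverse.to σ v)

    position-injective : ∀ {x y} → position x ≡ position y → x ≡ y
    position-injective {x} {y} eq = begin
      x                               ≡⟨ Inverse.strictlyInverseʳ σ x ⟨
      Inverse.from σ (Inverse.to σ x) ≡⟨ cong (Inverse.from σ) (toℕ-injective eq) ⟩
      Inverse.from σ (Inverse.to σ y) ≡⟨ Inverse.strictlyInverseʳ σ y ⟩
      y                               ∎
      where open ≡-Reasoning

    position-<⇒≢ : ∀ {x y} → position x < position y → x ≢ y
    position-<⇒≢ x<y refl = <-irrefl refl x<y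

    earliest : ∀ {Q : V → Set} → (∀ v → Dec (Q v)) → ∀ {v} → Q v →
               ∃ λ u → Q u × (∀ {w} → position w < position u → ¬ Q w)
    earliest Q? {v} qv with least (λ i → any? λ u → position u ≟ i ×-dec Q? u) (v , refl , qv)
    ... | _ , (u , refl , qu) , first = u , qu , λ w<u qw → first w<u (_ , refl , qw)

  -- Pan- and diamond-free graphs: every DFS ordering is a LexDFS ordering

  module _ (σ : Ordering G) (dfs : IsDFS G σ) {a b c : V}
           (a<b : position σ a < position σ b) (b<c : position σ b < position σ c)
           (a~c : a ~ c) (a≁b : ¬ (a ~ b)) where

    private
      pos : V → ℕ
      pos = position σ

    record LeftmostNeighbour (x y : V) : Set where
      field
        after-a  : pos a < pos y
        left-of  : pos y < pos x
        adjacent : x ~ y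
        leftmost : ∀ {v} → pos a < pos v → pos v < pos y → ¬ (x ~ v)
    open LeftmostNeighbour

    leftmostNeighbour : ∀ {x} → pos a < pos x → pos x < pos c → ¬ (a ~ x) → ∃ (LeftmostNeighbour x)
    leftmostNeighbour {x} a<x x<c a≁x with dfs a x c a<x x<c a~c a≁x
    ... | d , a<d , d<x , d~x
      with earliest σ (λ v → pos a <? pos v ×-dec (pos v <? pos x ×-dec E? G x v)) (a<d , d<x , ~-sym d~x)
    ... | y , (a<y , y<x , x~y) , first = y , record
      { after-a  = a<y
      ; left-of  = y<x
      ; adjacent = x~y
      ; leftmost = λ a<v v<y x~v → first v<y (a<v , <-trans v<y y<x , x~v)
      }

    record Descent (m : ℕ) (z : ℕ → V) : Set where
      field
        head   : z 0 ≡ b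
        next   : Consecutive LeftmostNeighbour m z
        a-free : ∀ {t} → suc t < m → ¬ (a ~ z t)
    open Descent

    module _ {m z} (d : Descent m z) where

      descending : ∀ {t u} → t < u → u < m → pos (z u) < pos (z t)
      descending {t} {suc u} t<1+u 1+u<m with m<1+n⇒m<n∨m≡n t<1+u
      ... | inj₁ t<u = <-trans (left-of (next d 1+u<m)) (descending t<u (<-trans (n<1+n u) 1+u<m))
      ... | inj₂ refl = left-of (next d 1+u<m)

      descent-after-a : ∀ {t} → t < m → pos a < pos (z t)
      descent-after-a {zero} _ = subst (λ v → pos a < pos v) (sym (head d)) a<b
      descent-after-a {suc t} 1+t<m = after-a (next d 1+t<m)

      descent-before-c : ∀ {t} → t < m → pos (z t) < pos c
      descent-before-c {zero} _ = subst (λ v → pos v < pos c) (sym (head d)) b<c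
      descent-before-c {suc t} 1+t<m =
        <-trans (descending (s≤s z≤n) 1+t<m) (descent-before-c (<-trans (s≤s z≤n) 1+t<m))

      descent⇒isInducedPath : IsInducedPath m z
      descent⇒isInducedPath = record
        { isPath    = record { distinct = distinct ; steps = λ 1+t<m → adjacent (next d 1+t<m) }
        ; chordless = chordless
        }
        where
        distinct : InjectiveBelow m z
        distinct {t} {u} t<m u<m eq with <-cmp t u
        ... | tri< t<u _ _ = contradiction (sym eq) (position-<⇒≢ σ (descending t<u u<m))
        ... | tri≈ _ t≡u _ = t≡u
        ... | tri> _ _ u<t = contradiction eq (position-<⇒≢ σ (descending u<t t<m))

        chordless : ∀ {t u} → t < u → u < m → z t ~ z u → suc t ≡ u
        chordless t<u u<m e with m≤n⇒m<n∨m≡n t<u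
        ... | inj₂ 1+t≡u = 1+t≡u
        ... | inj₁ 1+t<u =
          contradiction e (leftmost (next d (<-trans 1+t<u u<m)) (descent-after-a u<m) (descending 1+t<u u<m))

    descent-snoc : ∀ {j z y} → Descent (suc j) z → LeftmostNeighbour (z j) y → ¬ (a ~ z j) →
                   Descent (suc (suc j)) (snoc z (suc j) y)
    descent-snoc {j} {z} {y} d y-next a≁zj = record
      { head   = trans (snoc-< {s = z} {m = suc j} {x = y} (s≤s z≤n)) (head d)
      ; next   = snoc-consecutive {R = LeftmostNeighbour} (next d) y-next
      ; a-free = snoc-consecutive {R = λ x _ → ¬ (a ~ x)} (a-free d) a≁zj
      }

    descent-reaches-a : ∀ fuel {j z} → Descent (suc j) z → pos (z j) < fuel →
                        ∃₂ λ j z → Descent (suc j) z × a ~ z j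
    descent-reaches-a (suc fuel) {j} {z} d zj<1+fuel with E? G a (z j)
    ... | yes a~zj = j , z , d , a~zj
    ... | no a≁zj with leftmostNeighbour (descent-after-a d ≤-refl) (descent-before-c d ≤-refl) a≁zj
    ... | y , y-next = descent-reaches-a fuel (descent-snoc d y-next a≁zj)
      (subst (λ v → pos v < fuel) (sym (snoc-last {s = z} {m = suc j}))
             (<-≤-trans (left-of y-next) (s≤s⁻¹ zj<1+fuel)))

    start : Descent 1 (λ _ → b)
    start = record { head = refl ; next = λ { (s≤s ()) } ; a-free = λ { (s≤s ()) } }

    descent-second : ∀ {j z} → Descent (suc (suc j)) z → LeftmostNeighbour b (z 1)
    descent-second {z = z} d = subst (λ v → LeftmostNeighbour v (z 1)) (head d) (next d (s≤s (s≤s z≤n)))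

    module _ (pan-free : ¬ HasInducedPan) (diamond-free : ¬ InducedCopy 4 DiamondAdj G) where

      b≁c : ∀ {x} → LeftmostNeighbour b x → x ~ c → ¬ (b ~ c)
      b≁c {x} first x~c b~c with E? G a x
      ... | yes a~x = diamond-free (diamond⇒copy a~x a~c x~c (~-sym (adjacent first)) (~-sym b~c) a≁b
                                                 (position-<⇒≢ σ a<b))
      ... | no a≁x = pan-free (closingVertex⇒pan a-c-x ≤-refl b-fresh a≁b (~-sym b~c) (~-sym (adjacent first)))
        where
        a-c-x : IsInducedPath 3 (snoc (snoc (λ _ → a) 1 c) 2 x)
        a-c-x = snoc-isInducedPath
          (snoc-isInducedPath (singleton-isInducedPath a) a~c (λ ())
                              λ { (s≤s z≤n) → position-<⇒≢ σ (<-trans a<b b<c) })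
          (~-sym x~c) (λ { (s≤s z≤n) → a≁x })
          λ { (s≤s z≤n) → position-<⇒≢ σ (after-a first)
            ; (s≤s (s≤s z≤n)) c≡x → position-<⇒≢ σ (<-trans (left-of first) b<c) (sym c≡x) }

        b-fresh : ∀ {t} → t < 3 → snoc (snoc (λ _ → a) 1 c) 2 x t ≢ b
        b-fresh (s≤s z≤n) = position-<⇒≢ σ a<b
        b-fresh (s≤s (s≤s z≤n)) c≡b = position-<⇒≢ σ b<c (sym c≡b)
        b-fresh (s≤s (s≤s (s≤s z≤n))) = position-<⇒≢ σ (left-of first)

      second≁c : ∀ {j z} → Descent (suc (suc j)) z → a ~ z (suc j) → ¬ (z 1 ~ c)
      second≁c {j} {z} d a~zj z1~c =
        pan-free (closingVertex⇒pan path (s≤s (s≤s z≤n)) c-fresh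
                    (λ b~c → b≁c (descent-second d) z1~c (subst (_~ c) (head d) b~c)) z1~c
                    (subst (_~ c) (sym (snoc-last {s = z} {m = suc (suc j)})) a~c))
        where
        path : IsInducedPath (suc (suc (suc j))) (snoc z (suc (suc j)) a)
        path = snoc-isInducedPath (descent⇒isInducedPath d) (~-sym a~zj)
          (λ t<1+j e → a-free d (s≤s t<1+j) (~-sym e))
          (λ t<2+j eq → position-<⇒≢ σ (descent-after-a d t<2+j) (sym eq))

        c-fresh : ∀ {t} → t < suc (suc (suc j)) → snoc z (suc (suc j)) a t ≢ c
        c-fresh = snoc-all {P = _≢ c} (λ t<2+j → position-<⇒≢ σ (descent-before-c d t<2+j))
                                       (position-<⇒≢ σ (<-trans a<b b<c))

      lexDFS-witness : ∃ λ d → pos a < pos d × pos d < pos b × d ~ b × ¬ (d ~ c)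
      lexDFS-witness with descent-reaches-a (suc (pos b)) start ≤-refl
      ... | zero , z , d , a~z0 = contradiction (subst (a ~_) (head d) a~z0) a≁b
      ... | suc j , z , d , a~zj = let first = descent-second d in
        z 1 , after-a first , left-of first , ~-sym (adjacent first) , second≁c d a~zj

  -- DFS orderings beginning with a given path

  Visited : ℕ → (ℕ → V) → V → Set
  Visited m s v = ∃ λ t → t < m × s t ≡ v

  visited? : ∀ m s v → Dec (Visited m s v)
  visited? m s v = anyUpTo? (λ t → s t ≟ᶠ v) m

  injectiveBelow⇒≤ : ∀ {m s} → InjectiveBelow m s → m ≤ n G
  injectiveBelow⇒≤ {m} {s} inj =
    injective⇒≤ {f = λ (i : Fin m) → s (toℕ i)} λ eq → toℕ-injective (inj (toℕ<n _) (toℕ<n _) eq)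

  unvisited : ∀ {m s} → m < n G → InjectiveBelow m s → ∃ λ v → ¬ Visited m s v
  unvisited {m} {s} m<N inj = ¬∀⟶∃¬ (n G) (Visited m s) (visited? m s) λ all →
    <⇒≱ m<N (injective⇒≤ {f = index all} (index-injective all))
    where
    index : (∀ v → Visited m s v) → V → Fin m
    index all v = fromℕ< (proj₁ (proj₂ (all v)))

    index-injective : ∀ all {v w} → index all v ≡ index all w → v ≡ w
    index-injective all {v} {w} eq = begin
      v                 ≡⟨ proj₂ (proj₂ (all v)) ⟨
      s (proj₁ (all v)) ≡⟨ cong s same-index ⟩
      s (proj₁ (all w)) ≡⟨ proj₂ (proj₂ (all w)) ⟩
      w                 ∎
      where
      open ≡-Reasoning
      same-index : proj₁ (all v) ≡ proj₁ (all w)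
      same-index = trans (sym (toℕ-fromℕ< _)) (trans (cong toℕ eq) (toℕ-fromℕ< _))

  all-visited : ∀ {s} → InjectiveBelow (n G) s → ∀ v → Visited (n G) s v
  all-visited {s} inj v with visited? (n G) s v
  ... | yes vis = vis
  ... | no unvis = contradiction
    (injectiveBelow⇒≤ (snoc-injective inj λ t<N st≡v → unvis (_ , t<N , st≡v))) (<-irrefl refl)

  walk-exits : ∀ {P : V → Set} → (∀ v → Dec (P v)) → ∀ {x y} → Walk G x y → P x → ¬ P y →
               ∃₂ λ u v → P u × ¬ P v × u ~ v
  walk-exits P? here px ¬py = contradiction px ¬py
  walk-exits P? (step {y = y} x~y walk) px ¬pz with P? y
  ... | yes py = walk-exits P? walk py ¬pz
  ... | no ¬py = _ , _ , px , ¬py , x~y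

  -- The DFS condition on s 0, …, s (m - 1), with "c is none of s 0, …, s l" in place of "c comes after s l".
  record DFSPrefix (m : ℕ) (s : ℕ → V) : Set where
    field
      distinct : InjectiveBelow m s
      dfs      : ∀ {i l c} → i < l → l < m → (∀ {t} → t ≤ l → s t ≢ c) → s i ~ c → ¬ (s i ~ s l) →
                 ∃ λ d → i < d × d < l × s d ~ s l

  isPath⇒dfsPrefix : ∀ {m p} → IsPath m p → DFSPrefix m p
  isPath⇒dfsPrefix {m} {p} path = record { distinct = IsPath.distinct path ; dfs = predecessor }
    where
    predecessor : ∀ {i l c} → i < l → l < m → (∀ {t} → t ≤ l → p t ≢ c) → p i ~ c → ¬ (p i ~ p l) →
                  ∃ λ d → i < d × d < l × p d ~ p l
    predecessor {i} {suc l} i<1+l 1+l<m _ _ pi≁pl with m<1+n⇒m<n∨m≡n i<1+l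
    ... | inj₁ i<l = l , i<l , ≤-refl , IsPath.steps path 1+l<m
    ... | inj₂ refl = contradiction (IsPath.steps path 1+l<m) pi≁pl

  HasUnvisitedNeighbour : ℕ → (ℕ → V) → ℕ → Set
  HasUnvisitedNeighbour m s t = ∃ λ v → ¬ Visited m s v × s t ~ v

  dfsPrefix-snoc : ∀ {j s t w} → DFSPrefix (suc j) s → t < suc j → ¬ Visited (suc j) s w → s t ~ w →
                   (∀ {u} → t < u → u < suc j → ¬ HasUnvisitedNeighbour (suc j) s u) →
                   DFSPrefix (suc (suc j)) (snoc s (suc j) w)
  dfsPrefix-snoc {j} {s} {t} {w} prefix t<1+j w-unvisited st~w latest = record
    { distinct = snoc-injective distinct λ u<1+j su≡w → w-unvisited (_ , u<1+j , su≡w)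
    ; dfs      = dfs′
    }
    where
    open DFSPrefix prefix
    s′ : ℕ → V
    s′ = snoc s (suc j) w

    agree : ∀ {u} → u < suc j → s′ u ≡ s u
    agree = snoc-<

    dfs′ : ∀ {i l c} → i < l → l < suc (suc j) → (∀ {u} → u ≤ l → s′ u ≢ c) → s′ i ~ c →
           ¬ (s′ i ~ s′ l) →
           ∃ λ d → i < d × d < l × s′ d ~ s′ l
    dfs′ {i} {l} {c} i<l l<2+j c-new si~c si≁sl with snoc-view {s = s} {m = suc j} {x = w} {t = l} l<2+j
    ... | old l<1+j sl≡sl =
      let i<1+j = <-trans i<l l<1+j
          (d , i<d , d<l , sd~sl) = dfs i<l l<1+j
                                        (λ u≤l su≡c → c-new u≤l (trans (agree (≤-<-trans u≤l l<1+j)) su≡c))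
                                        (subst (_~ c) (agree i<1+j) si~c)
                                        (λ e → si≁sl (subst₂ _~_ (sym (agree i<1+j)) (sym sl≡sl) e))
      in d , i<d , d<l , subst₂ _~_ (sym (agree (<-trans d<l l<1+j))) (sym sl≡sl) sd~sl
    ... | new refl sl≡w with <-cmp i t
    ...   | tri< i<t _ _ = t , i<t , t<1+j , subst₂ _~_ (sym (agree t<1+j)) (sym sl≡w) st~w
    ...   | tri≈ _ refl _ = contradiction (subst₂ _~_ (sym (agree t<1+j)) (sym sl≡w) st~w) si≁sl
    ...   | tri> _ _ t<i = contradiction (c , c-unvisited , subst (_~ c) (agree i<l) si~c) (latest t<i i<l)
      where
      c-unvisited : ¬ Visited (suc j) s c
      c-unvisited (u , u<1+j , su≡c) = c-new (<⇒≤ u<1+j) (trans (agree u<1+j) su≡c)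

  sequence⇒ordering : ∀ {s} → InjectiveBelow (n G) s →
                      Σ (Ordering G) λ σ → ∀ {t} → t < n G → position σ (s t) ≡ t
  sequence⇒ordering {s} inj = mk↔ₛ′ index (s ∘ toℕ) index-entry entry-index , position-entry
    where
    index : V → Fin (n G)
    index v = fromℕ< (proj₁ (proj₂ (all-visited inj v)))

    entry-index : ∀ v → s (toℕ (index v)) ≡ v
    entry-index v = trans (cong s (toℕ-fromℕ< _)) (proj₂ (proj₂ (all-visited inj v)))

    position-entry : ∀ {t} → t < n G → toℕ (index (s t)) ≡ t
    position-entry t<N = inj (toℕ<n _) t<N (entry-index (s _))

    index-entry : ∀ i → index (s (toℕ i)) ≡ i
    index-entry i = toℕ-injective (position-entry (toℕ<n i))

  dfsPrefix⇒isDFS : ∀ {s} (σ : Ordering G) → DFSPrefix (n G) s →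
                    (∀ {t} → t < n G → position σ (s t) ≡ t) → IsDFS G σ
  dfsPrefix⇒isDFS {s} σ prefix position-s a b c a<b b<c a~c a≁b =
    let (d , a<d , d<b , sd~b) = DFSPrefix.dfs prefix a<b (toℕ<n _) c-later
                                   (subst (_~ c) (sym (entry a)) a~c) (λ e → a≁b (subst₂ _~_ (entry a) (entry b) e))
        d-position = position-s (<-trans d<b (toℕ<n _))
    in s d , subst (position σ a <_) (sym d-position) a<d
           , subst (_< position σ b) (sym d-position) d<b
           , subst (s d ~_) (entry b) sd~b
    where
    entry : ∀ v → s (position σ v) ≡ v
    entry v = position-injective σ (position-s (toℕ<n _))

    c-later : ∀ {t} → t ≤ position σ b → s t ≢ c
    c-later {t} t≤b st≡c = <⇒≱ b<c (subst (_≤ position σ b) (sym c-position) t≤b)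
      where
      c-position : position σ c ≡ t
      c-position = trans (cong (position σ) (sym st≡c)) (position-s (≤-<-trans t≤b (toℕ<n _)))

  module _ (connected : Connected G) where

    dfsPrefix-grow : ∀ {j s} → DFSPrefix (suc j) s → suc j < n G →
                     ∃ λ w → DFSPrefix (suc (suc j)) (snoc s (suc j) w)
    dfsPrefix-grow {j} {s} prefix 1+j<N
      with greatest-below (λ t → any? λ v → ¬? (visited? (suc j) s v) ×-dec E? G (s t) v) some
      where
      some : ∃ λ t → t < suc j × HasUnvisitedNeighbour (suc j) s t
      some with unvisited 1+j<N (DFSPrefix.distinct prefix)
      ... | u , u-unvisited
        with walk-exits (visited? (suc j) s) (connected (s 0) u) (0 , s≤s z≤n , refl) u-unvisited
      ... | _ , v , (t , t<1+j , refl) , v-unvisited , e = t , t<1+j , v , v-unvisited , e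
    ... | t , t<1+j , (w , w-unvisited , st~w) , latest = w , dfsPrefix-snoc prefix t<1+j w-unvisited st~w latest

    dfsPrefix-complete : ∀ r {j s} → suc j + r ≡ n G → DFSPrefix (suc j) s →
                         ∃ λ s′ → DFSPrefix (n G) s′ × (∀ {t} → t < suc j → s′ t ≡ s t)
    dfsPrefix-complete zero {j} {s} 1+j+0≡N prefix =
      s , subst (λ m → DFSPrefix m s) (trans (sym (+-identityʳ (suc j))) 1+j+0≡N) prefix , λ _ → refl
    dfsPrefix-complete (suc r) {j} {s} 1+j+1+r≡N prefix
      with dfsPrefix-grow prefix (subst (suc j <_) 1+j+1+r≡N (m<m+n (suc j) (s≤s z≤n)))
    ... | w , prefix′ with dfsPrefix-complete r (trans (sym (+-suc (suc j) r)) 1+j+1+r≡N) prefix′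
    ... | s′ , complete , agrees = s′ , complete , λ t<1+j → trans (agrees (m<n⇒m<1+n t<1+j)) (snoc-< t<1+j)

    isPath⇒dfsOrdering : ∀ {m p} → IsPath (suc m) p →
                         Σ (Ordering G) λ σ → IsDFS G σ × (∀ {t} → t < suc m → position σ (p t) ≡ t)
    isPath⇒dfsOrdering {m} {p} path =
      let (s , complete , agrees) = dfsPrefix-complete (n G ∸ suc m) (m+[n∸m]≡n 1+m≤N) (isPath⇒dfsPrefix path)
          (σ , position-s) = sequence⇒ordering (DFSPrefix.distinct complete)
      in σ , dfsPrefix⇒isDFS σ complete position-s
           , λ t<1+m → trans (cong (position σ) (sym (agrees t<1+m))) (position-s (<-≤-trans t<1+m 1+m≤N))
      where
      1+m≤N : suc m ≤ n G
      1+m≤N = injectiveBelow⇒≤ (IsPath.distinct path)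

  -- Pans and diamonds yield DFS orderings that are not LexDFS orderings

  EveryDFSIsLexDFS : Set
  EveryDFSIsLexDFS = (σ : Ordering G) → IsDFS G σ → IsLexDFS G σ

  prefix⇒¬isLexDFS : ∀ {m} {p : ℕ → V} {c : V} (σ : Ordering G) →
                     (∀ {t} → t < suc m → position σ (p t) ≡ t) → 1 ≤ m →
                     (∀ {t} → t < suc m → p t ≢ c) → p 0 ~ c → ¬ (p 0 ~ p m) →
                     (∀ {t} → 0 < t → t < m → p t ~ p m → p t ~ c) → ¬ IsLexDFS G σ
  prefix⇒¬isLexDFS {m} {p} {c} σ position-p 1≤m c-fresh p0~c p0≁pm inner lex =
    let (d , a<d , d<b , d~b , d≁c) = lex (p 0) (p m) c a<b b<c p0~c p0≁pm
        d<m = subst (position σ d <_) (position-p ≤-refl) d<b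
        pd≡d = entry (m<n⇒m<1+n d<m)
    in d≁c (subst (_~ c) pd≡d
             (inner (subst (_< position σ d) (position-p (s≤s z≤n)) a<d) d<m (subst (_~ p m) (sym pd≡d) d~b)))
    where
    entry : ∀ {v} → position σ v < suc m → p (position σ v) ≡ v
    entry v<1+m = position-injective σ (position-p v<1+m)

    a<b : position σ (p 0) < position σ (p m)
    a<b = subst₂ _<_ (sym (position-p (s≤s z≤n))) (sym (position-p ≤-refl)) 1≤m

    b<c : position σ (p m) < position σ c
    b<c = subst (_< position σ c) (sym (position-p ≤-refl)) (≮⇒≥ λ c<1+m → c-fresh c<1+m (entry c<1+m))

  path⇒¬everyDFSIsLexDFS : Connected G → ∀ {m} {p : ℕ → V} {c : V} → IsPath (suc m) p → 1 ≤ m →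
                           (∀ {t} → t < suc m → p t ≢ c) → p 0 ~ c → ¬ (p 0 ~ p m) →
                           (∀ {t} → 0 < t → t < m → p t ~ p m → p t ~ c) → ¬ EveryDFSIsLexDFS
  path⇒¬everyDFSIsLexDFS connected path 1≤m c-fresh p0~c p0≁pm inner every =
    let (σ , isDFS , position-p) = isPath⇒dfsOrdering connected path
    in prefix⇒¬isLexDFS σ position-p 1≤m c-fresh p0~c p0≁pm inner (every σ isDFS)

  module CopyVertices {k} {R : ℕ → ℕ → Set} (copy : InducedCopy (suc k) (λ i j → R (toℕ i) (toℕ j)) G) where

    vertex : ℕ → V
    vertex t with t <? suc k
    ... | yes t<1+k = proj₁ copy (fromℕ< t<1+k)
    ... | no _ = proj₁ copy 0F

    vertex-fromℕ< : ∀ {t} (t<1+k : t < suc k) → vertex t ≡ proj₁ copy (fromℕ< t<1+k)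
    vertex-fromℕ< {t} t<1+k with t <? suc k
    ... | yes _ = refl
    ... | no t≮1+k = contradiction t<1+k t≮1+k

    vertex-injective : InjectiveBelow (suc k) vertex
    vertex-injective t<1+k u<1+k eq = begin
      _                         ≡⟨ toℕ-fromℕ< t<1+k ⟨
      toℕ (fromℕ< t<1+k)        ≡⟨ cong toℕ (proj₁ (proj₂ copy) same-vertex) ⟩
      toℕ (fromℕ< u<1+k)        ≡⟨ toℕ-fromℕ< u<1+k ⟩
      _                         ∎
      where
      open ≡-Reasoning
      same-vertex = trans (sym (vertex-fromℕ< t<1+k)) (trans eq (vertex-fromℕ< u<1+k))

    vertex-adjacent : ∀ {t u} → t < suc k → u < suc k → R t u ⇔ vertex t ~ vertex u
    vertex-adjacent {t} {u} t<1+k u<1+k rewrite vertex-fromℕ< t<1+k | vertex-fromℕ< u<1+k =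
      subst₂ (λ x y → R x y ⇔ proj₁ copy (fromℕ< t<1+k) ~ proj₁ copy (fromℕ< u<1+k))
             (toℕ-fromℕ< t<1+k) (toℕ-fromℕ< u<1+k)
             (proj₂ (proj₂ copy) (fromℕ< t<1+k) (fromℕ< u<1+k))

    vertex-isPath : ∀ {m ρ} → (∀ {t} → t < m → ρ t < suc k) → InjectiveBelow m ρ → Consecutive R m ρ →
                    IsPath m (vertex ∘ ρ)
    vertex-isPath bound inj steps = record
      { distinct = λ t<m u<m eq → inj t<m u<m (vertex-injective (bound t<m) (bound u<m) eq)
      ; steps    = λ 1+t<m → Equivalence.to (vertex-adjacent (bound (<-trans (n<1+n _) 1+t<m)) (bound 1+t<m))
                                            (steps 1+t<m)
      }

  pan⇒¬everyDFSIsLexDFS : Connected G → ∀ {k} → 3 ≤ k → InducedCopy (suc k) (PanAdj k) G →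
                          ¬ EveryDFSIsLexDFS
  pan⇒¬everyDFSIsLexDFS connected {suc (suc (suc q))} (s≤s (s≤s (s≤s _))) copy =
    path⇒¬everyDFSIsLexDFS connected (vertex-isPath ρ-bound ρ-injective ρ-steps) (s≤s z≤n)
      (λ t<k eq → ρ≢1 t<k (vertex-injective (ρ-bound t<k) 1<1+k eq))
      (edge (m<n⇒m<1+n 2<k) 1<1+k (inj₁ (2<k , 1<k , inj₂ (inj₁ refl))))
      (λ e → 2≢0 (panAdjℕ-pendant (nonedge (m<n⇒m<1+n 2<k) ≤-refl (subst (λ v → vertex 2 ~ vertex v) ρ-last e))))
      inner
    where
    k : ℕ
    k = suc (suc (suc q))

    open CopyVertices {k = k} {R = PanAdjℕ k} copy

    edge : ∀ {t u} → t < suc k → u < suc k → PanAdjℕ k t u → vertex t ~ vertex u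
    edge t<1+k u<1+k = Equivalence.to (vertex-adjacent t<1+k u<1+k)

    nonedge : ∀ {t u} → t < suc k → u < suc k → vertex t ~ vertex u → PanAdjℕ k t u
    nonedge t<1+k u<1+k = Equivalence.from (vertex-adjacent t<1+k u<1+k)

    1<k : 1 < k
    1<k = s≤s (s≤s z≤n)

    2<k : 2 < k
    2<k = s≤s (s≤s (s≤s z≤n))

    1<1+k : 1 < suc k
    1<1+k = m<n⇒m<1+n 1<k

    2≢0 : 2 ≢ 0
    2≢0 ()

    -- The path 2, 3, …, k - 1, 0, k; the omitted cycle vertex 1 is adjacent to 2 and to 0.
    ρ : ℕ → ℕ
    ρ = snoc (snoc (2 +_) (suc q) 0) (suc (suc q)) k

    ρ-last : ρ (suc (suc q)) ≡ k
    ρ-last = snoc-last {s = snoc (2 +_) (suc q) 0} {m = suc (suc q)}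

    ρ-bound : ∀ {t} → t < k → ρ t < suc k
    ρ-bound = snoc-all {P = _< suc k}
      (snoc-all {P = _< suc k} (λ t<1+q → s≤s (s≤s (m<n⇒m<1+n t<1+q))) (s≤s z≤n)) ≤-refl

    ρ≢1 : ∀ {t} → t < k → ρ t ≢ 1
    ρ≢1 = snoc-all {P = _≢ 1} (snoc-all {P = _≢ 1} (λ _ ()) (λ ())) (λ ())

    ρ-injective : InjectiveBelow k ρ
    ρ-injective = snoc-injective (snoc-injective (λ _ _ → suc-injective ∘ suc-injective) (λ _ ()))
                                 (snoc-all {P = _≢ k} (λ t<1+q → <⇒≢ (s≤s (s≤s t<1+q))) (λ ()))

    ρ-steps : Consecutive (PanAdjℕ k) k ρ
    ρ-steps = snoc-consecutive {R = PanAdjℕ k}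
      (snoc-consecutive {R = PanAdjℕ k} around (inj₁ (≤-refl , s≤s z≤n , inj₂ (inj₂ (refl , refl)))))
      (subst (λ v → PanAdjℕ k v k) (sym (snoc-last {s = 2 +_} {m = suc q})) (inj₂ (inj₂ (refl , refl))))
      where
      around : Consecutive (PanAdjℕ k) (suc q) (2 +_)
      around 1+t<1+q = inj₁ (<-trans (n<1+n _) 3+t<k , 3+t<k , inj₁ (inj₁ refl))
        where 3+t<k = s≤s (s≤s (s≤s (s≤s⁻¹ 1+t<1+q)))

    inner : ∀ {t} → 0 < t → t < suc (suc q) → vertex (ρ t) ~ vertex (ρ (suc (suc q))) → vertex (ρ t) ~ vertex 1
    inner {t} _ t<m e = subst (λ v → vertex v ~ vertex 1) (sym ρt≡0)
      (edge (s≤s z≤n) 1<1+k (inj₁ (s≤s z≤n , 1<k , inj₁ (inj₁ refl))))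
      where
      ρt≡0 : ρ t ≡ 0
      ρt≡0 = panAdjℕ-pendant
        (nonedge (ρ-bound (m<n⇒m<1+n t<m)) ≤-refl (subst (λ v → vertex (ρ t) ~ vertex v) ρ-last e))

  diamond⇒¬everyDFSIsLexDFS : Connected G → InducedCopy 4 DiamondAdj G → ¬ EveryDFSIsLexDFS
  diamond⇒¬everyDFSIsLexDFS connected copy =
    path⇒¬everyDFSIsLexDFS connected (vertex-isPath ρ-bound ρ-injective ρ-steps) (s≤s z≤n)
      (λ t<3 eq → ρ≢2 t<3 (vertex-injective (ρ-bound t<3) (s≤s (s≤s (s≤s z≤n))) eq))
      (edge 0 2)
      (λ e → from-no (diamondAdjℕ? 0 3) (Equivalence.from (vertex-adjacent (s≤s z≤n) ≤-refl) e))
      λ { {1} _ _ _ → edge 1 2 ; {suc (suc _)} _ (s≤s (s≤s ())) }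
    where
    open CopyVertices {k = 3} {R = DiamondAdjℕ} copy

    edge : ∀ t u {t<4 : True (t <? 4)} {u<4 : True (u <? 4)} {t~u : True (diamondAdjℕ? t u)} →
           vertex t ~ vertex u
    edge t u {t<4} {u<4} {t~u} = Equivalence.to (vertex-adjacent (toWitness t<4) (toWitness u<4)) (toWitness t~u)

    -- The path 0, 1, 3; vertex 2 is adjacent to 0 and to 1.
    ρ : ℕ → ℕ
    ρ = snoc (snoc (λ _ → 0) 1 1) 2 3

    ρ-bound : ∀ {t} → t < 3 → ρ t < 4
    ρ-bound = snoc-all {P = _< 4} (snoc-all {P = _< 4} (λ _ → s≤s z≤n) (s≤s (s≤s z≤n))) ≤-refl

    ρ≢2 : ∀ {t} → t < 3 → ρ t ≢ 2
    ρ≢2 = snoc-all {P = _≢ 2} (snoc-all {P = _≢ 2} (λ _ ()) (λ ())) (λ ())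

    ρ-injective : InjectiveBelow 3 ρ
    ρ-injective = snoc-injective (snoc-injective injectiveBelow-1 (λ _ ())) (snoc-all {P = _≢ 3} (λ _ ()) (λ ()))

    ρ-steps : Consecutive DiamondAdjℕ 3 ρ
    ρ-steps = snoc-consecutive {R = DiamondAdjℕ}
      (snoc-consecutive {R = DiamondAdjℕ} (consecutive-1 {R = DiamondAdjℕ}) (from-yes (diamondAdjℕ? 0 1)))
      (from-yes (diamondAdjℕ? 1 3))

corollary3 : (G : Graph) → Connected G →
    ((σ : Ordering G) → IsDFS G σ → IsLexDFS G σ) ⇔ PanDiamondFree G
corollary3 G connected = mk⇔ forbids permits
  where
  forbids : EveryDFSIsLexDFS G → PanDiamondFree G
  forbids every = (λ k 3≤k pan → pan⇒¬everyDFSIsLexDFS G connected 3≤k pan every)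
                , (λ diamond → diamond⇒¬everyDFSIsLexDFS G connected diamond every)

  permits : PanDiamondFree G → EveryDFSIsLexDFS G
  permits (pan-free , diamond-free) σ dfs a b c a<b b<c a~c a≁b =
    lexDFS-witness G σ dfs a<b b<c a~c a≁b (λ (k , 3≤k , pan) → pan-free k 3≤k pan) diamond-free
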